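{- Let $(F_i)_{i\in\omega}$ be a sequence of subsets of $\varepsilon_0$ such that for every $i\in\omega$: (i) $F_i\neq\emptyset$; (ii) if $\alpha\in F_i$ and $\beta<\alpha$, then $\beta\in F_i$; (iii) if $\alpha\in F_i$, $\beta\in F_{i+1}$ and $\ell(\alpha)<\beta$, then $\alpha+\omega^\beta\in F_i$. Then the set $F:=\{\vec\alpha\in I:\forall i\ \alpha_i\in F_i\}$ is a filter in the Ignatiev algebra $\mathfrak{I}$.
   Context: Ordinal conventions: $\varepsilon_0$ is the least ordinal $\varepsilon$ with $\omega^\varepsilon=\varepsilon$, identified with the set of smaller ordinals. For an ordinal $\alpha>0$, $\ell(\alpha)$ is the unique $\beta$ such that $\alpha=\gamma+\omega^\beta$ for some $\gamma$. Also $\ell(0)=0$. Ignatiev sequences: $I$ is the set of sequences $\vec\alpha=(\alpha_i)_{i\in\omega}$ of ordinals $<\varepsilon_0$ with $\alpha_{i+1}\le\ell(\alpha_i)$ for all $i$. Such sequences are eventually $0$. Ignatiev algebra $\mathfrak{I}$: its universe is $I$. The order is $\vec\alpha\le_\mathfrak{I}\vec\beta$ iff $\alpha_i\ge\beta_i$ for all $i$. The meet $\vec\alpha\land_\mathfrak{I}\vec\beta$ is the $\le_\mathfrak{I}$-greatest lower bound. Explicitly, put $\gamma_i=\max(\alpha_i,\beta_i)$ and take $N$ with $\gamma_i=0$ for $i\ge N$. Then $\vec\delta=\vec\alpha\land_\mathfrak{I}\vec\beta$ has $\delta_i=0$ for $i\ge N$, and downward for $i<N$: $\delta_i=\gamma_i$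 if $\ell(\gamma_i)\ge\delta_{i+1}$, and $\delta_i=\gamma_i+\omega^{\delta_{i+1}}$ otherwise. Filters: a filter in $\mathfrak{I}$ is a nonempty $F\subseteq I$ that is upward closed under $\le_\mathfrak{I}$ and closed under $\land_\mathfrak{I}$. -}

module Defs where

open import Data.Nat using (ℕ; suc)
open import Data.Bool using (Bool; true; false; _∧_; _∨_; T; if_then_else_)
open import Data.Unit using (⊤)
open import Data.Product using (_×_; ∃)
open import Data.Sum using (_⊎_)
open import Relation.Binary.PropositionalEquality using (_≡_)

-- Cantor normal form terms: ω^ a + b.  Ordinals < ε₀ are the terms
-- satisfying IsNF (exponents weakly decreasing), and equality of ordinals
-- is syntactic equality of normal forms.
infixr 6 ω^_+_
data Cnf : Set where
  𝟎 : Cnf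
  ω^_+_ : Cnf → Cnf → Cnf

_==_ : Cnf → Cnf → Bool
𝟎 == 𝟎 = true
𝟎 == (ω^ _ + _) = false
(ω^ _ + _) == 𝟎 = false
(ω^ a + b) == (ω^ c + d) = (a == c) ∧ (b == d)

_<ᵇ_ : Cnf → Cnf → Bool
𝟎 <ᵇ 𝟎 = false
𝟎 <ᵇ (ω^ _ + _) = true
(ω^ _ + _) <ᵇ 𝟎 = false
(ω^ a + b) <ᵇ (ω^ c + d) = (a <ᵇ c) ∨ ((a == c) ∧ (b <ᵇ d))

infix 4 _<_ _≤_
_<_ : Cnf → Cnf → Set
a < b = T (a <ᵇ b)

_≤_ : Cnf → Cnf → Set
a ≤ b = a < b ⊎ a ≡ b

LeadLE : Cnf → Cnf → Set
LeadLE 𝟎 a = ⊤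
LeadLE (ω^ c + d) a = c ≤ a

data IsNF : Cnf → Set where
  nf𝟎 : IsNF 𝟎
  nfω : ∀ {a b} → IsNF a → IsNF b → LeadLE b a → IsNF (ω^ a + b)

infixl 5 _⊕_
_⊕_ : Cnf → Cnf → Cnf
𝟎 ⊕ β = β
(ω^ a + b) ⊕ 𝟎 = ω^ a + b
(ω^ a + b) ⊕ (ω^ c + d) =
  if a <ᵇ c then ω^ c + d else ω^ a + (b ⊕ (ω^ c + d))

ωpow : Cnf → Cnf
ωpow β = ω^ β + 𝟎

ℓ : Cnf → Cnf
ℓ 𝟎 = 𝟎
ℓ (ω^ a + 𝟎) = a
ℓ (ω^ a + (ω^ c + d)) = ℓ (ω^ c + d)

Seq : Set
Seq = ℕ → Cnf

I : Seq → Set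
I α = (∀ i → IsNF (α i)) × (∀ i → α (suc i) ≤ ℓ (α i))

infix 4 _≤I_
_≤I_ : Seq → Seq → Set
α ≤I β = ∀ i → β i ≤ α i

IsMeet : Seq → Seq → Seq → Set
IsMeet δ α β =
  I δ × δ ≤I α × δ ≤I β × (∀ η → I η → η ≤I α → η ≤I β → η ≤I δ)

IsFilter : (Seq → Set) → Set
IsFilter F =
  (∀ α → F α → I α) ×
  (∃ λ α → F α) ×
  (∀ α β → F α → I β → α ≤I β → F β) ×
  (∀ α β δ → F α → F β → IsMeet δ α β → F δ)

module Submission where

-- The real content is closure under meets.  Let δ = α ∧ β with
-- α, β ∈ F and put γᵢ = max(αᵢ, βᵢ) ∈ Fᵢ.  The universal property of the
-- meet yields the bound
--     (∗)  δᵢ ≤ x  for every x with γᵢ ≤ x and δᵢ₊₁ ≤ ℓ(x),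
-- because x can be placed at position i of a sequence η ∈ I with η ≤I α, β
-- (positions above i are copied from δ, positions below are γⱼ + ω^{ηⱼ₊₁}).
-- Hence δᵢ₊₁ ∈ Fᵢ₊₁ implies δᵢ ∈ Fᵢ: if δᵢ₊₁ ≤ ℓ(γᵢ) take x = γᵢ, otherwise
-- take x = γᵢ + ω^{δᵢ₊₁}, which lies in Fᵢ by hypothesis (iii).  This
-- backward step suffices since along an Ignatiev sequence the height of
-- the Cantor normal form strictly decreases until the sequence hits 0.

open import Defs
open import Data.Nat using (ℕ; suc; zero; z≤n; s≤s) renaming (_≤_ to _≤ℕ_; _<_ to _<ℕ_)
open import Data.Nat.Properties using () renaming (≤-refl to ≤ℕ-refl; ≤-trans to ≤ℕ-trans)
open import Data.Product using (_×_; ∃; _,_; proj₁; proj₂)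
open import Data.Bool using (true; false; T)
open import Data.Bool.Properties using (T-∧; T-∨)
open import Data.Sum using (_⊎_; inj₁; inj₂)
open import Data.Empty using (⊥-elim)
open import Data.Unit using (tt)
open import Function using (_∘_)
open import Function.Bundles using (Equivalence)
open import Relation.Binary.PropositionalEquality using (_≡_; refl; sym; cong; cong₂; subst)

open Equivalence using (to; from)

==-refl : ∀ a → T (a == a)
==-refl 𝟎 = tt
==-refl (ω^ a + b) = from T-∧ (==-refl a , ==-refl b)

==-sound : ∀ a b → T (a == b) → a ≡ b
==-sound 𝟎 𝟎 _ = refl
==-sound (ω^ a + b) (ω^ c + d) p =
  cong₂ ω^_+_ (==-sound a c (proj₁ (to T-∧ p))) (==-sound b d (proj₂ (to T-∧ p)))

<-by-exponent : ∀ a c b d → a < c → ω^ a + b < ω^ c + d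
<-by-exponent a c b d p = from T-∨ (inj₁ p)

<-by-tail : ∀ a b d → b < d → ω^ a + b < ω^ a + d
<-by-tail a b d p = from T-∨ (inj₂ (from T-∧ (==-refl a , p)))

<-cases : ∀ a b c d → ω^ a + b < ω^ c + d → a < c ⊎ (a ≡ c × b < d)
<-cases a b c d p with to T-∨ p
... | inj₁ q = inj₁ q
... | inj₂ q = inj₂ (==-sound a c (proj₁ (to T-∧ q)) , proj₂ (to T-∧ q))

<-trans : ∀ a b c → a < b → b < c → a < c
<-trans 𝟎 (ω^ _ + _) (ω^ _ + _) _ _ = tt
<-trans (ω^ a₁ + a₂) (ω^ b₁ + b₂) (ω^ c₁ + c₂) p q
  with <-cases a₁ a₂ b₁ b₂ p | <-cases b₁ b₂ c₁ c₂ q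
... | inj₁ x          | inj₁ y          = <-by-exponent a₁ c₁ a₂ c₂ (<-trans a₁ b₁ c₁ x y)
... | inj₁ x          | inj₂ (refl , _) = <-by-exponent a₁ c₁ a₂ c₂ x
... | inj₂ (refl , _) | inj₁ y          = <-by-exponent a₁ c₁ a₂ c₂ y
... | inj₂ (refl , x) | inj₂ (refl , y) = <-by-tail a₁ a₂ c₂ (<-trans a₂ b₂ c₂ x y)

≤-trans : ∀ {a b c} → a ≤ b → b ≤ c → a ≤ c
≤-trans {a} {b} {c} (inj₁ p) (inj₁ q) = inj₁ (<-trans a b c p q)
≤-trans (inj₁ p) (inj₂ refl) = inj₁ p
≤-trans (inj₂ refl) q = q

≤-or-> : ∀ a b → a ≤ b ⊎ b < a
≤-or-> 𝟎 𝟎 = inj₁ (inj₂ refl)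
≤-or-> 𝟎 (ω^ _ + _) = inj₁ (inj₁ tt)
≤-or-> (ω^ _ + _) 𝟎 = inj₂ tt
≤-or-> (ω^ a₁ + a₂) (ω^ b₁ + b₂) with ≤-or-> a₁ b₁
... | inj₂ p = inj₂ (<-by-exponent b₁ a₁ b₂ a₂ p)
... | inj₁ (inj₁ p) = inj₁ (inj₁ (<-by-exponent a₁ b₁ a₂ b₂ p))
... | inj₁ (inj₂ refl) with ≤-or-> a₂ b₂
...   | inj₁ (inj₁ p) = inj₁ (inj₁ (<-by-tail a₁ a₂ b₂ p))
...   | inj₁ (inj₂ refl) = inj₁ (inj₂ refl)
...   | inj₂ p = inj₂ (<-by-tail a₁ b₂ a₂ p)

<ᵇ-true : ∀ a b → a <ᵇ b ≡ true → a < b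
<ᵇ-true a b eq = subst T (sym eq) tt

<ᵇ-false : ∀ a b → a <ᵇ b ≡ false → b ≤ a
<ᵇ-false a b eq with ≤-or-> b a
... | inj₁ b≤a = b≤a
... | inj₂ a<b = ⊥-elim (subst T eq a<b)

-- y + ω^e is never 0, so prefixing a term does not change ℓ.
ℓ-prefix : ∀ a y e → ℓ (ω^ a + (y ⊕ ωpow e)) ≡ ℓ (y ⊕ ωpow e)
ℓ-prefix a 𝟎 e = refl
ℓ-prefix a (ω^ c + d) e with c <ᵇ e
... | true = refl
... | false = refl

ℓ-⊕ω : ∀ y e → ℓ (y ⊕ ωpow e) ≡ e
ℓ-⊕ω 𝟎 e = refl
ℓ-⊕ω (ω^ a + b) e with a <ᵇ e
... | true = refl
... | false = subst (_≡ e) (sym (ℓ-prefix a b e)) (ℓ-⊕ω b e)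

leadLE-⊕ω : ∀ b e a → LeadLE b a → e ≤ a → LeadLE (b ⊕ ωpow e) a
leadLE-⊕ω 𝟎 e a _ e≤a = e≤a
leadLE-⊕ω (ω^ c + d) e a lb e≤a with c <ᵇ e
... | true = e≤a
... | false = lb

IsNF-⊕ω : ∀ {y e} → IsNF y → IsNF e → IsNF (y ⊕ ωpow e)
IsNF-⊕ω nf𝟎 ne = nfω ne nf𝟎 tt
IsNF-⊕ω {ω^ a + b} {e} (nfω na nb lb) ne with a <ᵇ e in eq
... | true = nfω ne nf𝟎 tt
... | false = nfω na (IsNF-⊕ω nb ne) (leadLE-⊕ω b e a lb (<ᵇ-false a e eq))

≤-⊕ω : ∀ y e → y ≤ y ⊕ ωpow e
≤-⊕ω 𝟎 e = inj₁ tt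
≤-⊕ω (ω^ a + b) e with a <ᵇ e in eq
... | true = inj₁ (<-by-exponent a e b 𝟎 (<ᵇ-true a e eq))
... | false with ≤-⊕ω b e
...   | inj₁ p = inj₁ (<-by-tail a b _ p)
...   | inj₂ q = inj₂ (cong (ω^ a +_) q)

maxC : Cnf → Cnf → Cnf
maxC a b with a <ᵇ b
... | true = b
... | false = a

≤-maxˡ : ∀ a b → a ≤ maxC a b
≤-maxˡ a b with a <ᵇ b in eq
... | true = inj₁ (<ᵇ-true a b eq)
... | false = inj₂ refl

≤-maxʳ : ∀ a b → b ≤ maxC a b
≤-maxʳ a b with a <ᵇ b in eq
... | true = inj₂ refl
... | false = <ᵇ-false a b eq

-- The maximum is one of its arguments, so it inherits any common property.
max-preserves : ∀ (P : Cnf → Set) a b → P a → P b → P (maxC a b)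
max-preserves P a b pa pb with a <ᵇ b
... | true = pb
... | false = pa

max-least : ∀ {a b c} → a ≤ c → b ≤ c → maxC a b ≤ c
max-least {a} {b} {c} = max-preserves (_≤ c) a b

height : Cnf → ℕ
height 𝟎 = 0
height (ω^ a + _) = suc (height a)

height-mono : ∀ {x y} → x ≤ y → height x ≤ℕ height y
height-mono (inj₂ refl) = ≤ℕ-refl
height-mono {𝟎} (inj₁ _) = z≤n
height-mono {ω^ a + b} {ω^ c + d} (inj₁ p) with <-cases a b c d p
... | inj₁ q = s≤s (height-mono (inj₁ q))
... | inj₂ (refl , _) = ≤ℕ-refl

height-ℓ : ∀ {a b} → IsNF (ω^ a + b) → height (ℓ (ω^ a + b)) ≤ℕ height a
height-ℓ {a} {𝟎} _ = ≤ℕ-refl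
height-ℓ {a} {ω^ c + d} (nfω _ nb lb) = ≤ℕ-trans (height-ℓ nb) (height-mono lb)

height-descent : ∀ {z w} → IsNF z → w ≤ ℓ z → z ≡ 𝟎 ⊎ height w <ℕ height z
height-descent {𝟎} _ _ = inj₁ refl
height-descent {ω^ a + b} nz w≤ℓ = inj₂ (s≤s (≤ℕ-trans (height-mono w≤ℓ) (height-ℓ nz)))

I-backward-induction : ∀ {δ} → I δ → (Q : ℕ → Set)
  → (∀ i → δ i ≡ 𝟎 → Q i) → (∀ i → Q (suc i) → Q i) → ∀ i → Q i
I-backward-induction {δ} (nfδ , ℓδ) Q base step i = go (height (δ i)) i ≤ℕ-refl
  where
    go : ∀ k i → height (δ i) ≤ℕ k → Q i
    go k i hi with height-descent (nfδ i) (ℓδ i)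
    ... | inj₁ δi≡0 = base i δi≡0
    ... | inj₂ lt with k | ≤ℕ-trans lt hi
    ...   | suc k′ | s≤s hi′ = step i (go k′ (suc i) hi′)

infixr 5 _◂_
_◂_ : Cnf → Seq → Seq
(x ◂ s) zero = x
(x ◂ s) (suc j) = s j

tail-I : ∀ {s} → I s → I (s ∘ suc)
tail-I (nf , ℓs) = nf ∘ suc , ℓs ∘ suc

◂-I : ∀ {x s} → IsNF x → I s → s 0 ≤ ℓ x → I (x ◂ s)
◂-I nx (nf , ℓs) s₀≤ℓx = (λ { zero → nx ; (suc j) → nf j })
                        , (λ { zero → s₀≤ℓx ; (suc j) → ℓs j })

◂-≤I : ∀ {x s g} → g 0 ≤ x → s ≤I g ∘ suc → (x ◂ s) ≤I g
◂-≤I g₀≤x s≤g zero = g₀≤x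
◂-≤I g₀≤x s≤g (suc j) = s≤g j

-- Patching: inside a sequence s ∈ I lying below g, any x ≥ gᵢ with
-- sᵢ₊₁ ≤ ℓ(x) can be put at position i, keeping the tail of s and choosing
-- gⱼ + ω^{ηⱼ₊₁} below position i, to obtain a sequence η ∈ I below g.
patch : ∀ (g s : Seq) → (∀ j → IsNF (g j)) → I s → s ≤I g
  → ∀ i x → IsNF x → g i ≤ x → s (suc i) ≤ ℓ x
  → ∃ λ η → I η × η ≤I g × η i ≡ x
patch g s nfg Is s≤g zero x nx g₀≤x s₁≤ℓx =
  x ◂ (s ∘ suc) , ◂-I nx (tail-I Is) s₁≤ℓx , ◂-≤I g₀≤x (s≤g ∘ suc) , refl
patch g s nfg Is s≤g (suc i) x nx gᵢ≤x sᵢ≤ℓx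
  with patch (g ∘ suc) (s ∘ suc) (nfg ∘ suc) (tail-I Is) (s≤g ∘ suc) i x nx gᵢ≤x sᵢ≤ℓx
... | η , Iη , η≤g , ηᵢ≡x =
  (g 0 ⊕ ωpow (η 0)) ◂ η ,
  ◂-I (IsNF-⊕ω (nfg 0) (proj₁ Iη 0)) Iη (inj₂ (sym (ℓ-⊕ω (g 0) (η 0)))) ,
  ◂-≤I (≤-⊕ω (g 0) (η 0)) η≤g ,
  ηᵢ≡x

-- Patch x into δ below γ = max(α, β); the
-- result is a lower bound of α and β, hence lies below the meet δ.
meet-bound : ∀ {α β δ} → I α → I β → IsMeet δ α β
  → ∀ i x → IsNF x → maxC (α i) (β i) ≤ x → δ (suc i) ≤ ℓ x → δ i ≤ x
meet-bound {α} {β} {δ} Iα Iβ (Iδ , δ≤α , δ≤β , greatest) i x nx γ≤x δ≤ℓx =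
  let (η , Iη , η≤γ , ηᵢ≡x) = patch γ δ nfγ Iδ δ≤γ i x nx γ≤x δ≤ℓx
      η≤α : η ≤I α
      η≤α j = ≤-trans (≤-maxˡ (α j) (β j)) (η≤γ j)
      η≤β : η ≤I β
      η≤β j = ≤-trans (≤-maxʳ (α j) (β j)) (η≤γ j)
  in subst (δ i ≤_) ηᵢ≡x (greatest η Iη η≤α η≤β i)
  where
    γ : Seq
    γ j = maxC (α j) (β j)
    nfγ : ∀ j → IsNF (γ j)
    nfγ j = max-preserves IsNF (α j) (β j) (proj₁ Iα j) (proj₁ Iβ j)
    δ≤γ : δ ≤I γ
    δ≤γ j = max-least (δ≤α j) (δ≤β j)

module OrdinalFilter (Fs : ℕ → Cnf → Set)
    (nonempty : ∀ i → ∃ λ α → IsNF α × Fs i α)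
    (down : ∀ i α β → IsNF α → IsNF β → Fs i α → β < α → Fs i β)
    (up : ∀ i α β → IsNF α → IsNF β → Fs i α → Fs (suc i) β → ℓ α < β → Fs i (α ⊕ ωpow β))
  where

  down-≤ : ∀ {i x z} → IsNF x → IsNF z → Fs i x → z ≤ x → Fs i z
  down-≤ {i} {x} {z} nx nz fx (inj₁ z<x) = down i x z nx nz fx z<x
  down-≤ nx nz fx (inj₂ refl) = fx

  -- 0 ∈ Fᵢ, being below any witness of nonemptiness.
  zero∈F : ∀ i → Fs i 𝟎
  zero∈F i with nonempty i
  ... | 𝟎 , _ , f = f
  ... | (ω^ _ + _) , na , f = down i _ 𝟎 na nf𝟎 f tt

  meet-step : ∀ {α β δ} → I α → I β → IsMeet δ α β → ∀ i
    → Fs i (α i) → Fs i (β i) → Fs (suc i) (δ (suc i)) → Fs i (δ i)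
  meet-step {α} {β} {δ} Iα Iβ meet@(Iδ , _) i fα fβ fδ′ = by-cases (≤-or-> δ′ (ℓ γ))
    where
      γ : Cnf
      γ = maxC (α i) (β i)
      δ′ : Cnf
      δ′ = δ (suc i)
      nfγ : IsNF γ
      nfγ = max-preserves IsNF (α i) (β i) (proj₁ Iα i) (proj₁ Iβ i)
      nfδ′ : IsNF δ′
      nfδ′ = proj₁ Iδ (suc i)
      fγ : Fs i γ
      fγ = max-preserves (Fs i) (α i) (β i) fα fβ
      via : ∀ x → IsNF x → Fs i x → γ ≤ x → δ′ ≤ ℓ x → Fs i (δ i)
      via x nx fx γ≤x δ′≤ℓx =
        down-≤ nx (proj₁ Iδ i) fx (meet-bound Iα Iβ meet i x nx γ≤x δ′≤ℓx)
      -- x = γ if δ′ ≤ ℓ(γ); otherwise x = γ + ω^δ′, which is in Fᵢ by (iii).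
      by-cases : δ′ ≤ ℓ γ ⊎ ℓ γ < δ′ → Fs i (δ i)
      by-cases (inj₁ δ′≤ℓγ) = via γ nfγ fγ (inj₂ refl) δ′≤ℓγ
      by-cases (inj₂ ℓγ<δ′) =
        via (γ ⊕ ωpow δ′) (IsNF-⊕ω nfγ nfδ′) (up i γ δ′ nfγ nfδ′ fγ fδ′ ℓγ<δ′)
            (≤-⊕ω γ δ′) (inj₂ (sym (ℓ-⊕ω γ δ′)))

  -- Upward closure uses (ii) pointwise; meet closure runs the backward
  -- step along the meet, starting from the positions where it is 0.
  filter : IsFilter (λ α → I α × (∀ i → Fs i (α i)))
  filter =
    (λ α α∈F → proj₁ α∈F) ,
    ((λ _ → 𝟎) , ((λ _ → nf𝟎) , (λ _ → inj₂ refl)) , zero∈F) ,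
    (λ α β (Iα , fα) Iβ α≤β → Iβ , λ i → down-≤ (proj₁ Iα i) (proj₁ Iβ i) (fα i) (α≤β i)) ,
    (λ α β δ (Iα , fα) (Iβ , fβ) meet →
       proj₁ meet ,
       I-backward-induction (proj₁ meet) (λ i → Fs i (δ i))
         (λ i δᵢ≡0 → subst (Fs i) (sym δᵢ≡0) (zero∈F i))
         (λ i → meet-step Iα Iβ meet i (fα i) (fβ i)))

mainTheorem3 : (Fs : ℕ → Cnf → Set)
    → (∀ i → ∃ λ α → IsNF α × Fs i α)
    → (∀ i α β → IsNF α → IsNF β → Fs i α → β < α → Fs i β)
    → (∀ i α β → IsNF α → IsNF β → Fs i α → Fs (suc i) β → ℓ α < β → Fs i (α ⊕ ωpow β))
    → IsFilter (λ α → I α × (∀ i → Fs i (α i)))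
mainTheorem3 Fs nonempty down up = OrdinalFilter.filter Fs nonempty down up
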